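{- Let $k$ be a nonnegative integer, let $\lambda\in[0,1)$ and let $n$ be a positive integer. Then \[ \sum_{j=0}^{k}(-1)^{k-j}(n)_{j}\,\lambda^{j}B_{j}^{k}(\lambda)\,Y_{n-j}^{(k)}(\lambda)=0, \] where terms with $j>n$ are zero (since $(n)_j=0$ for $j>n$).
   Context: For a nonnegative integer $k$ and a number $\lambda\neq 1$, the numbers $Y_n^{(k)}(\lambda)$ are defined by the expansion (as formal power series in $t$) \[ \left(\frac{2}{\lambda(1+\lambda t)-1}\right)^{k}=\sum_{n=0}^{\infty}Y_{n}^{(k)}(\lambda)\frac{t^{n}}{n!}. \] $B_j^k(\lambda)=\binom{k}{j}\lambda^{j}(1-\lambda)^{k-j}$ are the Bernstein basis functions, and $(n)_j=n(n-1)\cdots(n-j+1)$ is the falling factorial with $(n)_0=1$. -}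

module Defs where

open import Level using (Level)
open import Data.Nat as ℕ using (ℕ; zero; suc; _∸_)
open import Algebra.Bundles using (CommutativeRing)

binom : ℕ → ℕ → ℕ
binom n       zero    = 1
binom zero    (suc j) = 0
binom (suc n) (suc j) = binom n j ℕ.+ binom n (suc j)

fallingFact : ℕ → ℕ → ℕ
fallingFact n zero    = 1
fallingFact n (suc j) = fallingFact n j ℕ.* (n ∸ j)

-- Everything is generic over a commutative ring R (the real numbers being
-- one instance).  A formal power series over R is its coefficient sequence.
module _ {c ℓ : Level} (R : CommutativeRing c ℓ) where
  open CommutativeRing R

  natR : ℕ → Carrier
  natR zero    = 0#
  natR (suc n) = 1# + natR n

  powR : Carrier → ℕ → Carrier
  powR x zero    = 1#
  powR x (suc n) = x * powR x n

  sumTo : ℕ → (ℕ → Carrier) → Carrier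
  sumTo zero    f = f 0
  sumTo (suc n) f = sumTo n f + f (suc n)

  Series : Set c
  Series = ℕ → Carrier

  constS : Carrier → Series
  constS a zero    = a
  constS a (suc n) = 0#

  mulS : Series → Series → Series
  mulS f g n = sumTo n (λ i → f i * g (n ∸ i))

  powS : Series → ℕ → Series
  powS f zero    = constS 1#
  powS f (suc k) = mulS f (powS f k)

  -- the series  λ(1 + λ t) - 1 = (λ - 1) + λ² t
  denomS : Carrier → Series
  denomS l zero          = l - 1#
  denomS l (suc zero)    = l * l
  denomS l (suc (suc n)) = 0#

  -- F is the power series 2 / (λ(1+λt) - 1), i.e. F · (λ(1+λt)-1) = 2
  IsYBase : Carrier → Series → Set ℓ
  IsYBase l F = ∀ n → mulS (denomS l) F n ≈ constS (1# + 1#) n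

  Y : Series → ℕ → ℕ → Carrier
  Y F k n = natR (n ℕ.!) * powS F k n

  bernstein : ℕ → ℕ → Carrier → Carrier
  bernstein j k l = natR (binom k j) * (powR l j * powR (1# - l) (k ∸ j))

  sign : ℕ → Carrier
  sign m = powR (- 1#) m

module Submission where

open import Defs
open import Level using (Level)
open import Data.Nat using (ℕ; _≤_; _∸_)
open import Data.Product using (∃)
open import Algebra.Bundles using (CommutativeRing)
open import Data.Nat as ℕ using (zero; suc; _<_; s≤s; z≤n; _!)
import Data.Nat.Properties as ℕₚ
open import Relation.Binary.PropositionalEquality as ≡ using (_≡_)
open import Relation.Nullary using (yes; no)

-- Write D(t) = λ(1+λt) - 1 = (λ-1) + λ²t and F = 2/D, so that D·F = 2.
-- Raising to the k-th power gives D^k · F^k = 2^k, a constant series, so the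
-- coefficient of t^n in D^k · F^k vanishes for n ≥ 1.  By the binomial theorem
-- [t^j] D^k = C(k,j) λ^{2j} (λ-1)^{k-j} = (-1)^{k-j} λ^j B_j^k(λ), and since
-- (n)_j (n-j)! = n! for j ≤ n, the j-th summand of the theorem equals
-- n! · [t^j] D^k · [t^{n-j}] F^k.  The sum is therefore n! · [t^n](D^k F^k) = 0
-- once the range j ≤ k is exchanged for j ≤ n (the summand vanishes for j > k
-- because C(k,j) = 0, and for j > n because (n)_j = 0).

binom-vanishes : ∀ k j → k < j → binom k j ≡ 0
binom-vanishes zero    (suc j) _       = ≡.refl
binom-vanishes (suc k) (suc j) (s≤s p) =
  ≡.cong₂ ℕ._+_ (binom-vanishes k j p) (binom-vanishes k (suc j) (ℕₚ.m<n⇒m<1+n p))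

fallingFact-vanishes : ∀ n j → n < j → fallingFact n j ≡ 0
fallingFact-vanishes n (suc j) (s≤s p) =
  ≡.trans (≡.cong (fallingFact n j ℕ.*_) (ℕₚ.m≤n⇒m∸n≡0 p)) (ℕₚ.*-zeroʳ (fallingFact n j))

factorial-unfold : ∀ {m r} → m ≡ suc r → m ℕ.* r ! ≡ m !
factorial-unfold ≡.refl = ≡.refl

fallingFact-factorial : ∀ n j → j ≤ n → fallingFact n j ℕ.* (n ∸ j) ! ≡ n !
fallingFact-factorial n zero    _   = ℕₚ.*-identityˡ (n !)
fallingFact-factorial n (suc j) j<n = begin
  fallingFact n j ℕ.* (n ∸ j) ℕ.* (n ∸ suc j) !   ≡⟨ ℕₚ.*-assoc (fallingFact n j) (n ∸ j) _ ⟩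
  fallingFact n j ℕ.* ((n ∸ j) ℕ.* (n ∸ suc j) !) ≡⟨ ≡.cong (fallingFact n j ℕ.*_)
                                                        (factorial-unfold (ℕₚ.+-∸-assoc 1 j<n)) ⟩
  fallingFact n j ℕ.* (n ∸ j) !                     ≡⟨ fallingFact-factorial n j (ℕₚ.<⇒≤ j<n) ⟩
  n ! ∎
  where open ≡.≡-Reasoning

module Development {c ℓ : Level} (R : CommutativeRing c ℓ) where
  open CommutativeRing R hiding (zero)
  open import Algebra.Solver.Ring.NaturalCoefficients.Default commutativeSemiring
  open import Relation.Binary.Reasoning.Setoid setoid
  import Algebra.Properties.Ring ring as RingProperties
  import Algebra.Properties.AbelianGroup +-abelianGroup as AbelianGroupProperties

  sum-cong : ∀ n {f g : ℕ → Carrier} → (∀ i → i ≤ n → f i ≈ g i) → sumTo R n f ≈ sumTo R n g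
  sum-cong zero    h = h 0 z≤n
  sum-cong (suc n) h = +-cong (sum-cong n (λ i p → h i (ℕₚ.m≤n⇒m≤1+n p))) (h (suc n) ℕₚ.≤-refl)

  sum-zero : ∀ n {f : ℕ → Carrier} → (∀ i → f i ≈ 0#) → sumTo R n f ≈ 0#
  sum-zero zero    h = h 0
  sum-zero (suc n) h = trans (+-cong (sum-zero n h) (h _)) (+-identityˡ 0#)

  sum-head : ∀ n f → sumTo R (suc n) f ≈ f 0 + sumTo R n (λ i → f (suc i))
  sum-head zero    f = refl
  sum-head (suc n) f = trans (+-cong (sum-head n f) refl) (+-assoc _ _ _)

  sum-+ : ∀ n f g → sumTo R n (λ i → f i + g i) ≈ sumTo R n f + sumTo R n g
  sum-+ zero    f g = refl
  sum-+ (suc n) f g = trans (+-cong (sum-+ n f g) refl)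
    (solve 4 (λ a b x y → (a :+ b) :+ (x :+ y) := (a :+ x) :+ (b :+ y)) refl _ _ _ _)

  sum-scale : ∀ n a f → sumTo R n (λ i → a * f i) ≈ a * sumTo R n f
  sum-scale zero    a f = refl
  sum-scale (suc n) a f = trans (+-cong (sum-scale n a f) refl) (sym (distribˡ a _ _))

  sum-reverse : ∀ n f → sumTo R n f ≈ sumTo R n (λ i → f (n ∸ i))
  sum-reverse zero    f = refl
  sum-reverse (suc n) f = trans (+-comm _ _)
    (trans (+-cong refl (sum-reverse n f)) (sym (sum-head n (λ i → f (suc n ∸ i)))))

  sum-pad : ∀ n d f → (∀ i → n < i → f i ≈ 0#) → sumTo R (d ℕ.+ n) f ≈ sumTo R n f
  sum-pad n zero    f h = refl
  sum-pad n (suc d) f h =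
    trans (+-cong (sum-pad n d f h) (h _ (s≤s (ℕₚ.m≤n+m n d)))) (+-identityʳ _)

  sum-truncate : ∀ m n f → (∀ i → m < i → f i ≈ 0#) → (∀ i → n < i → f i ≈ 0#) →
                 sumTo R m f ≈ sumTo R n f
  sum-truncate m n f hm hn = begin
    sumTo R m f           ≈⟨ sum-pad m n f hm ⟨
    sumTo R (n ℕ.+ m) f   ≡⟨ ≡.cong (λ x → sumTo R x f) (ℕₚ.+-comm n m) ⟩
    sumTo R (m ℕ.+ n) f   ≈⟨ sum-pad n m f hn ⟩
    sumTo R n f           ∎

  mulS-suc : ∀ f g n → mulS R f g (suc n) ≈ f 0 * g (suc n) + mulS R (λ i → f (suc i)) g n
  mulS-suc f g n = sum-head n (λ i → f i * g (suc n ∸ i))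

  mulS-cong : ∀ {f f′ g g′ : Series R} → (∀ i → f i ≈ f′ i) → (∀ i → g i ≈ g′ i) →
              ∀ n → mulS R f g n ≈ mulS R f′ g′ n
  mulS-cong hf hg n = sum-cong n (λ i _ → *-cong (hf i) (hg (n ∸ i)))

  mulS-comm : ∀ f g n → mulS R f g n ≈ mulS R g f n
  mulS-comm f g n = trans (sum-reverse n _)
    (sum-cong n (λ i i≤n → trans (*-comm _ _)
      (*-cong (reflexive (≡.cong g (ℕₚ.m∸[m∸n]≡n i≤n))) refl)))

  mulS-zeroˡ : ∀ g n → mulS R (λ _ → 0#) g n ≈ 0#
  mulS-zeroˡ g n = sum-zero n (λ i → zeroˡ _)

  mulS-distribʳ : ∀ f g h n → mulS R (λ i → f i + g i) h n ≈ mulS R f h n + mulS R g h n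
  mulS-distribʳ f g h n = trans (sum-cong n (λ i _ → distribʳ _ _ _)) (sum-+ n _ _)

  mulS-scaleˡ : ∀ a f h n → mulS R (λ i → a * f i) h n ≈ a * mulS R f h n
  mulS-scaleˡ a f h n = trans (sum-cong n (λ i _ → *-assoc _ _ _)) (sum-scale n a _)

  mulS-constˡ : ∀ a g n → mulS R (constS R a) g n ≈ a * g n
  mulS-constˡ a g zero    = refl
  mulS-constˡ a g (suc n) =
    trans (mulS-suc _ g n) (trans (+-cong refl (mulS-zeroˡ g n)) (+-identityʳ _))

  mulS-assoc : ∀ n f g h → mulS R (mulS R f g) h n ≈ mulS R f (mulS R g h) n
  mulS-assoc zero    f g h = *-assoc _ _ _
  mulS-assoc (suc n) f g h = begin
    mulS R fg h (suc n)
      ≈⟨ mulS-suc fg h n ⟩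
    fg 0 * h (suc n) + mulS R (λ i → fg (suc i)) h n
      ≈⟨ +-cong refl (mulS-cong {g = h} (λ i → mulS-suc f g i) (λ _ → refl) n) ⟩
    fg 0 * h (suc n) + mulS R (λ i → f 0 * g (suc i) + mulS R f′ g i) h n
      ≈⟨ +-cong refl (mulS-distribʳ (λ i → f 0 * g (suc i)) (mulS R f′ g) h n) ⟩
    fg 0 * h (suc n) + (mulS R (λ i → f 0 * g (suc i)) h n + mulS R (mulS R f′ g) h n)
      ≈⟨ +-cong refl (+-cong (mulS-scaleˡ (f 0) g′ h n) (mulS-assoc n f′ g h)) ⟩
    (f 0 * g 0) * h (suc n) + (f 0 * mulS R g′ h n + mulS R f′ (mulS R g h) n)
      ≈⟨ solve 5 (λ a b x y z → (a :* b) :* z :+ (a :* x :+ y) := a :* (b :* z :+ x) :+ y)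
           refl (f 0) (g 0) (mulS R g′ h n) (mulS R f′ (mulS R g h) n) (h (suc n)) ⟩
    f 0 * (g 0 * h (suc n) + mulS R g′ h n) + mulS R f′ (mulS R g h) n
      ≈⟨ +-cong (*-cong refl (mulS-suc g h n)) refl ⟨
    f 0 * mulS R g h (suc n) + mulS R f′ (mulS R g h) n
      ≈⟨ mulS-suc f (mulS R g h) n ⟨
    mulS R f (mulS R g h) (suc n) ∎
    where
    fg = mulS R f g
    f′ = λ i → f (suc i)
    g′ = λ i → g (suc i)

  -- (f g)(f′ g′) = (f f′)(g g′): the rearrangement behind (fg)^k = f^k g^k.
  mulS-interchange : ∀ f g f′ g′ n →
    mulS R (mulS R f f′) (mulS R g g′) n ≈ mulS R (mulS R f g) (mulS R f′ g′) n
  mulS-interchange f g f′ g′ n = begin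
    mulS R (mulS R f f′) (mulS R g g′) n   ≈⟨ mulS-assoc n f f′ (mulS R g g′) ⟩
    mulS R f (mulS R f′ (mulS R g g′)) n   ≈⟨ mulS-cong {f = f} (λ _ → refl) middle n ⟩
    mulS R f (mulS R g (mulS R f′ g′)) n   ≈⟨ mulS-assoc n f g (mulS R f′ g′) ⟨
    mulS R (mulS R f g) (mulS R f′ g′) n   ∎
    where
    middle : ∀ i → mulS R f′ (mulS R g g′) i ≈ mulS R g (mulS R f′ g′) i
    middle i = trans (sym (mulS-assoc i f′ g g′))
      (trans (mulS-cong {g = g′} (mulS-comm f′ g) (λ _ → refl) i) (mulS-assoc i g f′ g′))

  powS-product-constant : ∀ f g a → (∀ n → mulS R f g n ≈ constS R a n) →
    ∀ k n → mulS R (powS R f k) (powS R g k) n ≈ constS R (powR R a k) n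
  powS-product-constant f g a fg≈a zero n =
    trans (mulS-constˡ 1# (constS R 1#) n) (*-identityˡ _)
  powS-product-constant f g a fg≈a (suc k) n = begin
    mulS R (mulS R f fᵏ) (mulS R g gᵏ) n  ≈⟨ mulS-interchange f g fᵏ gᵏ n ⟩
    mulS R (mulS R f g) (mulS R fᵏ gᵏ) n  ≈⟨ mulS-cong {g = mulS R fᵏ gᵏ} fg≈a (λ _ → refl) n ⟩
    mulS R (constS R a) (mulS R fᵏ gᵏ) n  ≈⟨ mulS-constˡ a (mulS R fᵏ gᵏ) n ⟩
    a * mulS R fᵏ gᵏ n                    ≈⟨ *-cong refl (powS-product-constant f g a fg≈a k n) ⟩
    a * constS R (powR R a k) n           ≈⟨ scale-const n ⟩
    constS R (powR R a (suc k)) n         ∎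
    where
    fᵏ = powS R f k
    gᵏ = powS R g k
    scale-const : ∀ n → a * constS R (powR R a k) n ≈ constS R (powR R a (suc k)) n
    scale-const zero    = refl
    scale-const (suc n) = zeroʳ a

  natR-+ : ∀ x y → natR R (x ℕ.+ y) ≈ natR R x + natR R y
  natR-+ zero    y = sym (+-identityˡ _)
  natR-+ (suc x) y = trans (+-cong refl (natR-+ x y)) (sym (+-assoc _ _ _))

  natR-* : ∀ x y → natR R (x ℕ.* y) ≈ natR R x * natR R y
  natR-* zero    y = sym (zeroˡ _)
  natR-* (suc x) y = trans (natR-+ y (x ℕ.* y)) (trans (+-cong refl (natR-* x y))
    (sym (trans (distribʳ _ _ _) (+-cong (*-identityˡ _) refl))))

  powR-cong : ∀ {x y} → x ≈ y → ∀ m → powR R x m ≈ powR R y m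
  powR-cong p zero    = refl
  powR-cong p (suc m) = *-cong p (powR-cong p m)

  powR-* : ∀ x y m → powR R x m * powR R y m ≈ powR R (x * y) m
  powR-* x y zero    = *-identityˡ _
  powR-* x y (suc m) = trans
    (solve 4 (λ a b u v → (a :* u) :* (b :* v) := (a :* b) :* (u :* v))
       refl x y (powR R x m) (powR R y m))
    (*-cong refl (powR-* x y m))

  binomialTerm : Carrier → Carrier → ℕ → ℕ → Carrier
  binomialTerm a b k m = natR R (binom k m) * (powR R b m * powR R a (k ∸ m))

  -- a · C(k,m+1) b^(m+1) a^(k-m-1) = C(k,m+1) b^(m+1) a^(k-m); when m ≥ k both
  -- sides vanish because C(k,m+1) = 0.
  binomialTerm-lower : ∀ a b k m →
    a * binomialTerm a b k (suc m) ≈ natR R (binom k (suc m)) * (powR R b (suc m) * powR R a (k ∸ m))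
  binomialTerm-lower a b k m with m ℕₚ.<? k
  ... | yes m<k = trans
    (solve 4 (λ x c y z → x :* (c :* (y :* z)) := c :* (y :* (x :* z))) refl a C bᵐ⁺¹ aᵏ⁻ᵐ⁻¹)
    (*-cong refl (*-cong refl (reflexive (≡.cong (powR R a) (≡.sym (ℕₚ.+-∸-assoc 1 m<k))))))
    where
    C = natR R (binom k (suc m))
    bᵐ⁺¹ = powR R b (suc m)
    aᵏ⁻ᵐ⁻¹ = powR R a (k ∸ suc m)
  ... | no m≮k rewrite binom-vanishes k (suc m) (s≤s (ℕₚ.≮⇒≥ m≮k)) =
    trans (trans (*-cong refl (zeroˡ _)) (zeroʳ a)) (sym (zeroˡ _))

  binomialTerm-pascal : ∀ a b k m →
    binomialTerm a b (suc k) (suc m) ≈ a * binomialTerm a b k (suc m) + b * binomialTerm a b k m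
  binomialTerm-pascal a b k m = sym (begin
    a * binomialTerm a b k (suc m) + b * binomialTerm a b k m
      ≈⟨ +-cong (binomialTerm-lower a b k m) refl ⟩
    C₁ * (powR R b (suc m) * aᵏ⁻ᵐ) + b * (C₀ * (powR R b m * aᵏ⁻ᵐ))
      ≈⟨ solve 5 (λ c₁ c₀ y bm r → c₁ :* ((y :* bm) :* r) :+ y :* (c₀ :* (bm :* r))
                                  := (c₀ :+ c₁) :* ((y :* bm) :* r))
           refl C₁ C₀ b (powR R b m) aᵏ⁻ᵐ ⟩
    (C₀ + C₁) * (powR R b (suc m) * aᵏ⁻ᵐ)
      ≈⟨ *-cong (natR-+ (binom k m) (binom k (suc m))) refl ⟨
    binomialTerm a b (suc k) (suc m) ∎)
    where
    C₀ = natR R (binom k m)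
    C₁ = natR R (binom k (suc m))
    aᵏ⁻ᵐ = powR R a (k ∸ m)

  mulS-linear-tail : ∀ (f : Series R) → (∀ i → f (suc (suc i)) ≈ 0#) →
    ∀ (g : Series R) m → mulS R (λ i → f (suc i)) g m ≈ f 1 * g m
  mulS-linear-tail f f≈0 g zero    = refl
  mulS-linear-tail f f≈0 g (suc m) = trans (mulS-suc _ g m)
    (trans (+-cong refl (trans (mulS-cong {g = g} f≈0 (λ _ → refl) m) (mulS-zeroˡ g m))) (+-identityʳ _))

  powS-linear : ∀ (f : Series R) → (∀ i → f (suc (suc i)) ≈ 0#) →
    ∀ k m → powS R f k m ≈ binomialTerm (f 0) (f 1) k m
  powS-linear f f≈0 zero    zero    =
    sym (trans (*-cong (+-identityʳ 1#) (*-identityˡ 1#)) (*-identityˡ 1#))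
  powS-linear f f≈0 zero    (suc m) = sym (zeroˡ _)
  powS-linear f f≈0 (suc k) zero    = trans (*-cong refl (powS-linear f f≈0 k zero))
    (solve 3 (λ x n p → x :* (n :* (con 1 :* p)) := n :* (con 1 :* (x :* p)))
       refl (f 0) (natR R 1) (powR R (f 0) k))
  powS-linear f f≈0 (suc k) (suc m) = begin
    mulS R f (powS R f k) (suc m)
      ≈⟨ mulS-suc f (powS R f k) m ⟩
    f 0 * powS R f k (suc m) + mulS R (λ i → f (suc i)) (powS R f k) m
      ≈⟨ +-cong (*-cong refl (powS-linear f f≈0 k (suc m))) (mulS-linear-tail f f≈0 (powS R f k) m) ⟩
    f 0 * binomialTerm (f 0) (f 1) k (suc m) + f 1 * powS R f k m
      ≈⟨ +-cong refl (*-cong refl (powS-linear f f≈0 k m)) ⟩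
    f 0 * binomialTerm (f 0) (f 1) k (suc m) + f 1 * binomialTerm (f 0) (f 1) k m
      ≈⟨ binomialTerm-pascal (f 0) (f 1) k m ⟨
    binomialTerm (f 0) (f 1) (suc k) (suc m) ∎

  powS-linear-vanishes : ∀ (f : Series R) → (∀ i → f (suc (suc i)) ≈ 0#) →
    ∀ k m → k < m → powS R f k m ≈ 0#
  powS-linear-vanishes f f≈0 k m k<m = trans (powS-linear f f≈0 k m)
    (trans (*-cong (reflexive (≡.cong (natR R) (binom-vanishes k m k<m))) refl) (zeroˡ _))

  -- The key identity: (-1)^(k-j) λ^j B_j^k(λ) = [t^j] (λ(1+λt) - 1)^k, because
  -- λ^j λ^j = (λ²)^j and (-1)^(k-j) (1-λ)^(k-j) = (λ-1)^(k-j).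
  bernstein-denominator : ∀ l k j →
    sign R (k ∸ j) * (powR R l j * bernstein R j k l) ≈ powS R (denomS R l) k j
  bernstein-denominator l k j = begin
    sign R (k ∸ j) * (lʲ * (C * (lʲ * q)))
      ≈⟨ solve 4 (λ s L C Q → s :* (L :* (C :* (L :* Q))) := C :* ((L :* L) :* (s :* Q)))
           refl (sign R (k ∸ j)) lʲ C q ⟩
    C * ((lʲ * lʲ) * (sign R (k ∸ j) * q))
      ≈⟨ *-cong refl (*-cong (powR-* l l j) (trans (powR-* (- 1#) (1# - l) (k ∸ j))
                                                     (powR-cong minus-one-times (k ∸ j)))) ⟩
    binomialTerm (l - 1#) (l * l) k j
      ≈⟨ powS-linear (denomS R l) (λ _ → refl) k j ⟨
    powS R (denomS R l) k j ∎
    where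
    lʲ = powR R l j
    C = natR R (binom k j)
    q = powR R (1# - l) (k ∸ j)
    minus-one-times : - 1# * (1# - l) ≈ l - 1#
    minus-one-times = trans (RingProperties.-1*x≈-x _) (AbelianGroupProperties.⁻¹-anti-homo‿- 1# l)

  summand : Carrier → Series R → ℕ → ℕ → ℕ → Carrier
  summand l F k n j = sign R (k ∸ j) * (natR R (fallingFact n j)
    * (powR R l j * (bernstein R j k l * Y R F k (n ∸ j))))

  summand-coefficients : ∀ l F k n j → summand l F k n j ≈
    natR R (fallingFact n j ℕ.* (n ∸ j) !) * (powS R (denomS R l) k j * powS R F k (n ∸ j))
  summand-coefficients l F k n j = begin
    summand l F k n j
      ≈⟨ solve 6 (λ s f L B m g → s :* (f :* (L :* (B :* (m :* g))))
                                 := (f :* m) :* ((s :* (L :* B)) :* g))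
           refl (sign R (k ∸ j)) (natR R (fallingFact n j)) (powR R l j)
           (bernstein R j k l) (natR R ((n ∸ j) !)) (powS R F k (n ∸ j)) ⟩
    (natR R (fallingFact n j) * natR R ((n ∸ j) !))
      * ((sign R (k ∸ j) * (powR R l j * bernstein R j k l)) * powS R F k (n ∸ j))
      ≈⟨ *-cong (natR-* (fallingFact n j) ((n ∸ j) !)) (*-cong (sym (bernstein-denominator l k j)) refl) ⟨
    natR R (fallingFact n j ℕ.* (n ∸ j) !) * (powS R (denomS R l) k j * powS R F k (n ∸ j)) ∎

  summand-beyond-k : ∀ l F k n j → k < j → summand l F k n j ≈ 0#
  summand-beyond-k l F k n j k<j = trans (summand-coefficients l F k n j)
    (trans (*-cong refl (trans (*-cong (powS-linear-vanishes (denomS R l) (λ _ → refl) k j k<j) refl)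
                               (zeroˡ _)))
           (zeroʳ _))

  summand-beyond-n : ∀ l F k n j → n < j → summand l F k n j ≈ 0#
  summand-beyond-n l F k n j n<j rewrite fallingFact-vanishes n j n<j =
    trans (*-cong refl (zeroˡ _)) (zeroʳ _)

  summand-within-n : ∀ l F k n j → j ≤ n →
    summand l F k n j ≈ natR R (n !) * (powS R (denomS R l) k j * powS R F k (n ∸ j))
  summand-within-n l F k n j j≤n = trans (summand-coefficients l F k n j)
    (*-cong (reflexive (≡.cong (natR R) (fallingFact-factorial n j j≤n))) refl)

  summand-sum : ∀ l F → IsYBase R l F → ∀ k n → 1 ≤ n → sumTo R k (summand l F k n) ≈ 0#
  summand-sum l F isY k zero    ()
  summand-sum l F isY k (suc n) _ = begin
    sumTo R k (summand l F k (suc n))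
      ≈⟨ sum-truncate k (suc n) _ (summand-beyond-k l F k (suc n)) (summand-beyond-n l F k (suc n)) ⟩
    sumTo R (suc n) (summand l F k (suc n))
      ≈⟨ sum-cong (suc n) (summand-within-n l F k (suc n)) ⟩
    sumTo R (suc n) (λ j → natR R (suc n !) * (Dᵏ j * Fᵏ (suc n ∸ j)))
      ≈⟨ sum-scale (suc n) (natR R (suc n !)) _ ⟩
    natR R (suc n !) * mulS R Dᵏ Fᵏ (suc n)
      ≈⟨ *-cong refl (powS-product-constant (denomS R l) F (1# + 1#) isY k (suc n)) ⟩
    natR R (suc n !) * 0#
      ≈⟨ zeroʳ _ ⟩
    0# ∎
    where
    Dᵏ = powS R (denomS R l) k
    Fᵏ = powS R F k

mainTheorem6 : ∀ {c ℓ : Level} (R : CommutativeRing c ℓ) →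
    let open CommutativeRing R in
    (k : ℕ) (l : Carrier) → ∃ (λ u → u * (l - 1#) ≈ 1#) →
    (F : Series R) → IsYBase R l F →
    (n : ℕ) → 1 ≤ n →
    sumTo R k (λ j → sign R (k ∸ j) * (natR R (fallingFact n j)
    * (powR R l j * (bernstein R j k l * Y R F k (n ∸ j))))) ≈ 0#
mainTheorem6 R k l _ F isY n 1≤n = Development.summand-sum R l F isY k n 1≤n
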